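{- Let $G$ be a graph on the vertex set $V=\{v_1,\dots,v_n\}$ with at least one edge (i.e. $G$ is non-empty). The following statements are equivalent: (i) $G$ is a global amoeba; (ii) for each $x\in[n]$ there is some $y\in S_Gx$ with $\deg_G(v_y)=1$; (iii) $G\cup K_1$ is a local amoeba.
   Context: All graphs are finite and simple; $[n]=\{1,\dots,n\}$ and $S_n$ is the symmetric group on $[n]$, with composition $\sigma\rho=\sigma\circ\rho$. For a graph $G$ on vertex set $V=\{v_1,\dots,v_n\}$ let $L_G=\{ij : v_iv_j\in E(G)\}$ (unordered pairs). For $\sigma\in S_n$, $G_\sigma$ denotes the graph on $V$ with $E(G_\sigma)=\{v_{\sigma^{ -1}(i)}v_{\sigma^{ -1}(j)} : ij\in L_G\}$. For $e\in E(G)$ and $e'\in E(\overline G)\cup\{e\}$, the edge-replacement $e\to e'$ produces $G-e+e'$; it is feasible if $G-e+e'\cong G$. Let $R_G=\{rs\to kl : G-v_rv_s+v_kv_l\cong G\}$ be the set of feasible edge-replacements (written via labels), and for $rs\to kl\in R_G$ let $S_G(rs\to kl)=\{\sigma\in S_n : G_\sigma=G-v_rv_s+v_kv_l\}$. Let $\mathcal E_G=\bigcup_{rs\to kl\in R_G}S_G(rs\to kl)$ and $S_G=\langle\mathcal E_G\rangle\le S_n$. For $x\in[n]$, $S_Gx=\{\sigma(x):\sigma\in S_G\}$ is the orbit of $x$. A graph $G$ of order $n$ is a local amoeba if $S_G=S_n$. A graph $G$ is a global amoeba if there is an integer $T\ge 0$ such that $G\cup tK_1$ (the disjoint union of $G$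 with $t$ isolated vertices, labeled $v_{n+1},\dots,v_{n+t}$) is a local amoeba for all $t\ge T$. -}

module Defs where

open import Data.Nat using (ℕ; zero; suc; _+_; _≥_)
open import Data.Bool using (Bool; true; false; if_then_else_; _∧_; _∨_)
open import Data.Fin using (Fin; _≟_; splitAt)
open import Data.Fin.Permutation using (Permutation′; _⟨$⟩ʳ_; _∘ₚ_; flip; id)
open import Data.List using (List; map; allFin)
open import Data.Nat.ListAction using (sum)
open import Data.Sum using (_⊎_; inj₁; inj₂)
open import Data.Product using (Σ; _×_; ∃; ∃-syntax; _,_)
open import Relation.Nullary using (¬_)
open import Relation.Nullary.Decidable using (⌊_⌋)
open import Relation.Binary.PropositionalEquality using (_≡_; _≢_)

Adj : ℕ → Set
Adj n = Fin n → Fin n → Bool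

record IsSimple {n : ℕ} (G : Adj n) : Set where
  field
    sym     : ∀ i j → G i j ≡ G j i
    irrefl  : ∀ i → G i i ≡ false

_≐_ : ∀ {n} → Adj n → Adj n → Set
G ≐ H = ∀ i j → G i j ≡ H i j

NonEmpty : ∀ {n} → Adj n → Set
NonEmpty G = ∃[ i ] ∃[ j ] (G i j ≡ true)

-- G_σ : edges v_{σ⁻¹(i)} v_{σ⁻¹(j)} for ij ∈ L_G, i.e. a ~ b in G_σ iff σ(a) σ(b) ∈ L_G.
_^_ : ∀ {n} → Adj n → Permutation′ n → Adj n
(G ^ σ) a b = G (σ ⟨$⟩ʳ a) (σ ⟨$⟩ʳ b)

_≅_ : ∀ {n} → Adj n → Adj n → Set
G ≅ H = Σ (Permutation′ _) λ σ → (G ^ σ) ≐ H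

samePair : ∀ {n} → Fin n → Fin n → Fin n → Fin n → Bool
samePair i j k l = (⌊ i ≟ k ⌋ ∧ ⌊ j ≟ l ⌋) ∨ (⌊ i ≟ l ⌋ ∧ ⌊ j ≟ k ⌋)

replace : ∀ {n} → Adj n → Fin n → Fin n → Fin n → Fin n → Adj n
replace G r s k l i j =
  if samePair i j k l then true
  else if samePair i j r s then false
  else G i j

-- rs → kl is an edge-replacement: e = v_r v_s ∈ E(G), e' = v_k v_l ∈ E(Ḡ) ∪ {e}
IsEdgeReplacement : ∀ {n} → Adj n → Fin n → Fin n → Fin n → Fin n → Set
IsEdgeReplacement G r s k l =
  G r s ≡ true × k ≢ l × (G k l ≡ false ⊎ samePair k l r s ≡ true)

InR : ∀ {n} → Adj n → Fin n → Fin n → Fin n → Fin n → Set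
InR G r s k l = IsEdgeReplacement G r s k l × (replace G r s k l ≅ G)

InSrep : ∀ {n} → Adj n → Fin n → Fin n → Fin n → Fin n → Permutation′ n → Set
InSrep G r s k l σ = (G ^ σ) ≐ replace G r s k l

InE : ∀ {n} → Adj n → Permutation′ n → Set
InE {n} G σ = Σ (Fin n) λ r → Σ (Fin n) λ s → Σ (Fin n) λ k → Σ (Fin n) λ l →
  InR G r s k l × InSrep G r s k l σ

-- σ ∈ S_G = ⟨𝓔_G⟩ (subgroup of S_n generated by 𝓔_G; permutations up to pointwise equality)
data InSG {n : ℕ} (G : Adj n) : Permutation′ n → Set where
  gen  : ∀ {σ} → InE G σ → InSG G σ
  one  : InSG G id
  comp : ∀ {σ ρ} → InSG G σ → InSG G ρ → InSG G (σ ∘ₚ ρ)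
  inv  : ∀ {σ} → InSG G σ → InSG G (flip σ)
  ext  : ∀ {σ τ} → InSG G σ → (∀ i → σ ⟨$⟩ʳ i ≡ τ ⟨$⟩ʳ i) → InSG G τ

LocalAmoeba : ∀ {n} → Adj n → Set
LocalAmoeba {n} G = ∀ (σ : Permutation′ n) → InSG G σ

InOrbit : ∀ {n} → Adj n → Fin n → Fin n → Set
InOrbit G x y = Σ (Permutation′ _) λ σ → InSG G σ × σ ⟨$⟩ʳ x ≡ y

deg : ∀ {n} → Adj n → Fin n → ℕ
deg {n} G i = sum (map (λ j → if G i j then 1 else 0) (allFin n))

-- G ∪ tK₁ : new isolated vertices labelled v_{n+1},...,v_{n+t}
addIsolated : ∀ {n} → Adj n → (t : ℕ) → Adj (n + t)
addIsolated {n} G t a b with splitAt n a | splitAt n b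
... | inj₁ i | inj₁ j = G i j
... | _      | _      = false

GlobalAmoeba : ∀ {n} → Adj n → Set
GlobalAmoeba G = ∃[ T ] (∀ t → t ≥ T → LocalAmoeba (addIsolated G t))

-- For a simple graph G with at least one edge, write
-- H_t = G ∪ tK₁. Both (ii) ⇒ "H_{t+1} is a local amoeba" and
-- its converse are proved for every t; the theorem is then bookkeeping.
--
-- Sufficiency. Fix a new vertex z. Every transposition (a z) lies in S_H: for a new vertex it
-- swaps two isolated vertices (realised by rs → rs), for a leaf y with neighbour w it moves the
-- pendant edge yw to wz, and an arbitrary old vertex is conjugate to a leaf by the lift of an
-- element of S_G. Transpositions through one point generate the symmetric group.
--
-- Necessity. S_H preserves "isolated, or old with a leaf in its S_G-orbit" (module Necessity).
-- The key step is that a generator of S_H moving an old vertex of degree ≥ 2 to an old vertex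
-- descends to a generator of S_G: an added pair ending in a new isolated vertex is rerouted to an
-- endpoint of the deleted edge (which, by counting isolated vertices, becomes isolated), and the
-- relabelling is then adjusted to fix the new vertices and restricted to G. As S_H moves the
-- isolated vertex z to every old vertex, (ii) follows.

module Submission where

open import Defs
open import Data.Nat using (ℕ; zero; suc; _+_; _≤_; _<_; z≤n; s≤s) renaming (_≟_ to _≟ℕ_)
open import Data.Nat.Properties
  using (≤-trans; ≤-reflexive; m≤n⇒m≤1+n; n≤1+n; n≮n; m≤n+m; +-assoc; +-identityʳ; +-0-commutativeMonoid)
open import Data.Bool using (Bool; true; false; if_then_else_; _∧_; _∨_)
open import Data.Bool.Properties using (∧-comm; ∨-comm; ∧-zeroʳ; ∨-identityʳ)
open import Data.Fin using (Fin; zero; suc; _≟_; _↑ˡ_; _↑ʳ_; splitAt; join)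
open import Data.Fin.Properties using (suc-injective; splitAt-↑ˡ; splitAt-↑ʳ; splitAt⁻¹-↑ˡ; splitAt⁻¹-↑ʳ; ↑ˡ-injective; any?)
open import Data.Fin.Permutation
  using (Permutation′; permutation; _⟨$⟩ʳ_; _⟨$⟩ˡ_; _∘ₚ_; flip; id; transpose; inverseˡ; inverseʳ)
import Data.Fin.Permutation.Components as PC
open import Data.List using (List; []; _∷_; allFin; tabulate)
open import Data.List.Properties using (map-tabulate)
open import Data.List.Membership.Propositional using (_∈_; _∉_)
open import Data.List.Membership.Propositional.Properties using (∈-allFin; ∈-tabulate⁺; ∈-tabulate⁻)
open import Data.List.Relation.Unary.Any using (here; there)
import Data.Nat.ListAction as ListAction
open import Algebra.Properties.CommutativeMonoid.Sum +-0-commutativeMonoid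
  using (sum-permute) renaming (sum to ∑)
open import Data.Product using (Σ; ∃; _×_; _,_; proj₁; proj₂)
open import Data.Sum as Sum using (_⊎_; inj₁; inj₂; [_,_]′)
open import Data.Empty using (⊥-elim)
open import Relation.Nullary using (¬_; Dec; yes; no)
open import Relation.Nullary.Decidable using (⌊_⌋)
open import Relation.Binary.PropositionalEquality
  using (_≡_; _≢_; refl; sym; trans; cong; cong₂; subst; module ≡-Reasoning)
open import Function using (_∘_; case_of_)

_==_ : ∀ {m} → Fin m → Fin m → Bool
i == j = ⌊ i ≟ j ⌋

==-refl : ∀ {m} (i : Fin m) → (i == i) ≡ true
==-refl i with i ≟ i
... | yes _ = refl
... | no i≢i = ⊥-elim (i≢i refl)

==-true : ∀ {m} {i j : Fin m} → (i == j) ≡ true → i ≡ j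
==-true {i = i} {j} e with i ≟ j
... | yes i≡j = i≡j

==-false : ∀ {m} {i j : Fin m} → i ≢ j → (i == j) ≡ false
==-false {i = i} {j} i≢j with i ≟ j
... | yes i≡j = ⊥-elim (i≢j i≡j)
... | no _ = refl

==-inj : ∀ {m m'} (f : Fin m → Fin m') → (∀ {x y} → f x ≡ f y → x ≡ y) →
  ∀ i j → (f i == f j) ≡ (i == j)
==-inj f f-inj i j with i ≟ j
... | yes refl = ==-refl (f i)
... | no i≢j = ==-false (i≢j ∘ f-inj)

false≢true : false ≢ true
false≢true ()

not-true : ∀ {b} → b ≢ true → b ≡ false
not-true {false} _ = refl
not-true {true} b≢true = ⊥-elim (b≢true refl)

samePair-refl : ∀ {m} (i j : Fin m) → samePair i j i j ≡ true
samePair-refl i j rewrite ==-refl i | ==-refl j = refl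

samePair-swapˡ : ∀ {m} (i j k l : Fin m) → samePair i j k l ≡ samePair j i k l
samePair-swapˡ i j k l =
  trans (∨-comm (i == k ∧ j == l) _) (cong₂ _∨_ (∧-comm (i == l) _) (∧-comm (i == k) _))

samePair-swapʳ : ∀ {m} (i j k l : Fin m) → samePair i j k l ≡ samePair i j l k
samePair-swapʳ i j k l = ∨-comm (i == k ∧ j == l) _

samePair-true : ∀ {m} {i j k l : Fin m} → samePair i j k l ≡ true → (i ≡ k × j ≡ l) ⊎ (i ≡ l × j ≡ k)
samePair-true {i = i} {j} {k} {l} e with i ≟ k | j ≟ l | i ≟ l | j ≟ k
... | yes i≡k | yes j≡l | _     | _     = inj₁ (i≡k , j≡l)
... | yes _   | no _    | yes i≡l | yes j≡k = inj₂ (i≡l , j≡k)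
... | no _    | _       | yes i≡l | yes j≡k = inj₂ (i≡l , j≡k)

samePair-flip : ∀ {m} (i j : Fin m) → samePair i j j i ≡ true
samePair-flip i j = trans (samePair-swapʳ i j j i) (samePair-refl i j)

samePair-avoid : ∀ {m} {i j l : Fin m} (k : Fin m) → i ≢ l → j ≢ l → samePair i j k l ≡ false
samePair-avoid {i = i} {j} k i≢l j≢l rewrite ==-false i≢l | ==-false j≢l = cong₂ _∨_ (∧-zeroʳ (i == k)) refl

samePair-inj : ∀ {m m'} (f : Fin m → Fin m') → (∀ {x y} → f x ≡ f y → x ≡ y) → ∀ i j k l →
  samePair (f i) (f j) (f k) (f l) ≡ samePair i j k l
samePair-inj f f-inj i j k l
  rewrite ==-inj f f-inj i k | ==-inj f f-inj j l | ==-inj f f-inj i l | ==-inj f f-inj j k = refl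

samePair-miss : ∀ {m} {i k l : Fin m} (j : Fin m) → i ≢ k → i ≢ l → samePair i j k l ≡ false
samePair-miss {i = i} {k} {l} j i≢k i≢l rewrite ==-false i≢k | ==-false i≢l = refl

samePair-hit : ∀ {m} {k l : Fin m} (j : Fin m) → k ≢ l → samePair k j k l ≡ (j == l)
samePair-hit {k = k} {l} j k≢l rewrite ==-refl k | ==-false k≢l = ∨-identityʳ (j == l)

b2n : Bool → ℕ
b2n b = if b then 1 else 0

count : ∀ {m} → (Fin m → Bool) → ℕ
count f = ∑ (b2n ∘ f)

count-cong : ∀ {m} {f g : Fin m → Bool} → (∀ j → f j ≡ g j) → count f ≡ count g
count-cong {zero} e = refl
count-cong {suc m} e = cong₂ _+_ (cong b2n (e zero)) (count-cong (e ∘ suc))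

count-perm : ∀ {m} (f : Fin m → Bool) (π : Permutation′ m) → count (f ∘ (π ⟨$⟩ʳ_)) ≡ count f
count-perm f π = sym (sum-permute (b2n ∘ f) π)

count-zero⁺ : ∀ {m} (f : Fin m → Bool) → (∀ j → f j ≡ false) → count f ≡ 0
count-zero⁺ {zero} f none = refl
count-zero⁺ {suc m} f none rewrite none zero = count-zero⁺ (f ∘ suc) (none ∘ suc)

count-zero⁻ : ∀ {m} (f : Fin m → Bool) → count f ≡ 0 → ∀ j → f j ≡ false
count-zero⁻ {suc m} f c j with f zero in f0
count-zero⁻ {suc m} f c zero    | false = f0
count-zero⁻ {suc m} f c (suc j) | false = count-zero⁻ (f ∘ suc) c j

count-witness : ∀ {m} (f : Fin m → Bool) {c} → count f ≡ suc c → ∃ λ j → f j ≡ true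
count-witness {suc m} f c with f zero in f0
... | true = zero , f0
... | false = let (j , fj) = count-witness (f ∘ suc) c in suc j , fj

count-pos : ∀ {m} (f : Fin m → Bool) {j} → f j ≡ true → 1 ≤ count f
count-pos {suc m} f {zero} fj rewrite fj = s≤s z≤n
count-pos {suc m} f {suc j} fj = ≤-trans (count-pos (f ∘ suc) fj) (m≤n+m _ (b2n (f zero)))

count-two : ∀ {m} (f : Fin m → Bool) {i j} → i ≢ j → f i ≡ true → f j ≡ true → 2 ≤ count f
count-two f {zero} {zero} i≢j fi fj = ⊥-elim (i≢j refl)
count-two f {zero} {suc j} i≢j fi fj rewrite fi = s≤s (count-pos (f ∘ suc) fj)
count-two f {suc i} {zero} i≢j fi fj rewrite fj = s≤s (count-pos (f ∘ suc) fi)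
count-two f {suc i} {suc j} i≢j fi fj =
  ≤-trans (count-two (f ∘ suc) (i≢j ∘ cong suc) fi fj) (m≤n+m _ (b2n (f zero)))

count-≤1 : ∀ {m} (f : Fin m → Bool) (p : Fin m) → (∀ j → f j ≡ true → j ≡ p) → count f ≤ 1
count-≤1 {suc m} f zero only-p
  rewrite count-zero⁺ (f ∘ suc) (λ j → not-true (λ fj → case only-p (suc j) fj of λ ()))
  = ≤-trans (≤-reflexive (+-identityʳ (b2n (f zero)))) (b2n≤1 (f zero))
  where
  b2n≤1 : ∀ b → b2n b ≤ 1
  b2n≤1 false = z≤n
  b2n≤1 true = s≤s z≤n
count-≤1 {suc m} f (suc p) only-p with f zero in f0
... | false = count-≤1 (f ∘ suc) p (λ j fj → suc-injective (only-p (suc j) fj))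
... | true = case only-p zero f0 of λ ()

count-mono : ∀ {m} (f g : Fin m → Bool) → (∀ j → f j ≡ true → g j ≡ true) → count f ≤ count g
count-mono {zero} f g f⊆g = z≤n
count-mono {suc m} f g f⊆g with f zero in f0 | g zero in g0
... | false | false = count-mono (f ∘ suc) (g ∘ suc) (f⊆g ∘ suc)
... | false | true = m≤n⇒m≤1+n (count-mono (f ∘ suc) (g ∘ suc) (f⊆g ∘ suc))
... | true | true = s≤s (count-mono (f ∘ suc) (g ∘ suc) (f⊆g ∘ suc))
... | true | false = case trans (sym g0) (f⊆g zero f0) of λ ()

count-strict : ∀ {m} (f g : Fin m → Bool) → (∀ j → f j ≡ true → g j ≡ true) →
  ∀ k → f k ≡ false → g k ≡ true → count f < count g
count-strict f g f⊆g zero fk gk rewrite fk | gk = s≤s (count-mono (f ∘ suc) (g ∘ suc) (f⊆g ∘ suc))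
count-strict f g f⊆g (suc k) fk gk with f zero in f0 | g zero in g0
... | false | false = count-strict (f ∘ suc) (g ∘ suc) (f⊆g ∘ suc) k fk gk
... | false | true = m≤n⇒m≤1+n (count-strict (f ∘ suc) (g ∘ suc) (f⊆g ∘ suc) k fk gk)
... | true | true = s≤s (count-strict (f ∘ suc) (g ∘ suc) (f⊆g ∘ suc) k fk gk)
... | true | false = case trans (sym g0) (f⊆g zero f0) of λ ()

deg≡count : ∀ {m} (K : Adj m) a → deg K a ≡ count (K a)
deg≡count K a = trans (cong ListAction.sum (map-tabulate (λ j → j) (b2n ∘ K a))) (sum-tabulate (b2n ∘ K a))
  where
  sum-tabulate : ∀ {k} (f : Fin k → ℕ) → ListAction.sum (tabulate f) ≡ ∑ f
  sum-tabulate {zero} f = refl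
  sum-tabulate {suc k} f = cong (f zero +_) (sum-tabulate (f ∘ suc))

Symmetric : ∀ {m} → Adj m → Set
Symmetric K = ∀ i j → K i j ≡ K j i

Isolated : ∀ {m} → Adj m → Fin m → Set
Isolated K a = ∀ j → K a j ≡ false

isolated-col : ∀ {m} {K : Adj m} → Symmetric K → ∀ {a} → Isolated K a → ∀ j → K j a ≡ false
isolated-col S I j = trans (S j _) (I j)

perm-injective : ∀ {m} (σ : Permutation′ m) {x y} → σ ⟨$⟩ʳ x ≡ σ ⟨$⟩ʳ y → x ≡ y
perm-injective σ {x} {y} e = trans (sym (inverseˡ σ)) (trans (cong (σ ⟨$⟩ˡ_) e) (inverseˡ σ))

≐-sym : ∀ {m} {K K' : Adj m} → K ≐ K' → K' ≐ K
≐-sym e i j = sym (e i j)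

≐-trans : ∀ {m} {K K' K'' : Adj m} → K ≐ K' → K' ≐ K'' → K ≐ K''
≐-trans e f i j = trans (e i j) (f i j)

^-cong : ∀ {m} {K K' : Adj m} (π : Permutation′ m) → K ≐ K' → (K ^ π) ≐ (K' ^ π)
^-cong π e i j = e _ _

^-ext : ∀ {m} (K : Adj m) {π ρ : Permutation′ m} → (∀ x → π ⟨$⟩ʳ x ≡ ρ ⟨$⟩ʳ x) → (K ^ π) ≐ (K ^ ρ)
^-ext K e i j = cong₂ K (e i) (e j)

^-inverseʳ : ∀ {m} (K : Adj m) (π : Permutation′ m) → ((K ^ π) ^ flip π) ≐ K
^-inverseʳ K π i j = cong₂ K (inverseʳ π) (inverseʳ π)

degree-^ : ∀ {m} {K K' : Adj m} (π : Permutation′ m) → (K ^ π) ≐ K' → ∀ x →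
  count (K' x) ≡ count (K (π ⟨$⟩ʳ x))
degree-^ {K = K} π E x = trans (count-cong (λ j → sym (E x j))) (count-perm (K (π ⟨$⟩ʳ x)) π)

isolated-^⁺ : ∀ {m} {K K' : Adj m} (π : Permutation′ m) → (K ^ π) ≐ K' → ∀ x →
  Isolated K (π ⟨$⟩ʳ x) → Isolated K' x
isolated-^⁺ π E x I y = trans (sym (E x y)) (I _)

isolated-^⁻ : ∀ {m} {K K' : Adj m} (π : Permutation′ m) → (K ^ π) ≐ K' → ∀ x →
  Isolated K' x → Isolated K (π ⟨$⟩ʳ x)
isolated-^⁻ {K = K} π E x I v = trans (cong (K (π ⟨$⟩ʳ x)) (sym (inverseʳ π))) (trans (E x (π ⟨$⟩ˡ v)) (I _))

module _ {m} (i j : Fin m) where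
  transpose-left : transpose i j ⟨$⟩ʳ i ≡ j
  transpose-left with i ≟ i
  ... | yes _ = refl
  ... | no i≢i = ⊥-elim (i≢i refl)

  transpose-right : transpose i j ⟨$⟩ʳ j ≡ i
  transpose-right with j ≟ i
  ... | yes refl = refl
  ... | no _ with j ≟ j
  ...   | yes _ = refl
  ...   | no j≢j = ⊥-elim (j≢j refl)

  transpose-other : ∀ {k} → k ≢ i → k ≢ j → transpose i j ⟨$⟩ʳ k ≡ k
  transpose-other {k} k≢i k≢j with k ≟ i
  ... | yes k≡i = ⊥-elim (k≢i k≡i)
  ... | no _ with k ≟ j
  ...   | yes k≡j = ⊥-elim (k≢j k≡j)
  ...   | no _ = refl

  transpose-unique : (g : Fin m → Fin m) → g i ≡ j → g j ≡ i → (∀ k → k ≢ i → k ≢ j → g k ≡ k) →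
    ∀ k → transpose i j ⟨$⟩ʳ k ≡ g k
  transpose-unique g gi gj gk k = by-cases (k ≟ i) (k ≟ j)
    where
    by-cases : Dec (k ≡ i) → Dec (k ≡ j) → transpose i j ⟨$⟩ʳ k ≡ g k
    by-cases (yes refl) _ = trans transpose-left (sym gi)
    by-cases (no _) (yes refl) = trans transpose-right (sym gj)
    by-cases (no k≢i) (no k≢j) = trans (transpose-other k≢i k≢j) (sym (gk k k≢i k≢j))

transpose-comm : ∀ {m} (i j : Fin m) k → transpose i j ⟨$⟩ʳ k ≡ transpose j i ⟨$⟩ʳ k
transpose-comm i j = transpose-unique i j (transpose j i ⟨$⟩ʳ_)
  (transpose-right j i) (transpose-left j i) (λ k k≢i k≢j → transpose-other j i k≢j k≢i)

transpose-involutive : ∀ {m} (i j : Fin m) k → transpose i j ⟨$⟩ʳ (transpose i j ⟨$⟩ʳ k) ≡ k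
transpose-involutive i j k = trans (cong (transpose i j ⟨$⟩ʳ_) (transpose-comm i j k)) (PC.transpose-inverse i j)

transpose-self : ∀ {m} (i : Fin m) k → transpose i i ⟨$⟩ʳ k ≡ id ⟨$⟩ʳ k
transpose-self i = transpose-unique i i (λ k → k) refl refl (λ _ _ _ → refl)

transpose-conj : ∀ {m} (π : Permutation′ m) (p q : Fin m) → ∀ x →
  transpose (π ⟨$⟩ˡ p) (π ⟨$⟩ˡ q) ⟨$⟩ʳ x ≡ (π ∘ₚ transpose p q ∘ₚ flip π) ⟨$⟩ʳ x
transpose-conj π p q = transpose-unique (π ⟨$⟩ˡ p) (π ⟨$⟩ˡ q) _
  (cong (π ⟨$⟩ˡ_) (trans (cong (transpose p q ⟨$⟩ʳ_) (inverseʳ π)) (transpose-left p q)))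
  (cong (π ⟨$⟩ˡ_) (trans (cong (transpose p q ⟨$⟩ʳ_) (inverseʳ π)) (transpose-right p q)))
  (λ k k≢ k≢' → trans (cong (π ⟨$⟩ˡ_) (transpose-other p q (moved k≢) (moved k≢'))) (inverseˡ π))
  where
  moved : ∀ {k r} → k ≢ π ⟨$⟩ˡ r → π ⟨$⟩ʳ k ≢ r
  moved k≢ e = k≢ (trans (sym (inverseˡ π)) (cong (π ⟨$⟩ˡ_) e))

module _ {m} (K : Adj m) (z : Fin m) (star : ∀ a → InSG K (transpose a z)) where

  -- (a c) = (a z)(z c)(a z) for a, c, z distinct.
  all-transpositions : ∀ a c → InSG K (transpose a c)
  all-transpositions a c with c ≟ z | a ≟ z | a ≟ c
  ... | yes refl | _ | _ = star a
  ... | no _ | yes refl | _ = ext (star c) (transpose-comm c a)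
  ... | no _ | no _ | yes refl = ext one (λ x → sym (transpose-self a x))
  ... | no c≢z | no a≢z | no a≢c =
    ext (comp (star a) (comp (ext {τ = transpose z c} (star c) (transpose-comm c z)) (inv (star a))))
        (λ x → trans (sym (transpose-conj (transpose a z) z c x))
                     (cong₂ (λ u v → transpose u v ⟨$⟩ʳ x)
                            (transpose-left z a) (transpose-other z a c≢z (a≢c ∘ sym))))

  fixing-outside : (xs : List (Fin m)) (π : Permutation′ m) → (∀ i → i ∉ xs → π ⟨$⟩ʳ i ≡ i) → InSG K π
  fixing-outside [] π fixed = ext one (λ i → sym (fixed i (λ ())))
  fixing-outside (x ∷ xs) π fixed =
    ext (comp (fixing-outside xs (π ∘ₚ τ) fixed′) (all-transpositions x (π ⟨$⟩ʳ x)))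
        (λ y → transpose-involutive x (π ⟨$⟩ʳ x) (π ⟨$⟩ʳ y))
    where
    τ = transpose x (π ⟨$⟩ʳ x)
    fixed′ : ∀ i → i ∉ xs → τ ⟨$⟩ʳ (π ⟨$⟩ʳ i) ≡ i
    fixed′ i i∉xs with i ≟ x
    ... | yes refl = transpose-right x (π ⟨$⟩ʳ x)
    ... | no i≢x = trans (cong (τ ⟨$⟩ʳ_) πi≡i) (transpose-other x (π ⟨$⟩ʳ x) i≢x (i≢x ∘ perm-injective π ∘ trans πi≡i))
      where
      πi≡i : π ⟨$⟩ʳ i ≡ i
      πi≡i = fixed i λ { (here i≡x) → i≢x i≡x ; (there i∈xs) → i∉xs i∈xs }

  every-permutation : LocalAmoeba K
  every-permutation π = fixing-outside (allFin m) π (λ i i∉ → ⊥-elim (i∉ (∈-allFin i)))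

-- The pair kl may be added to K after deleting rs: it is a non-edge, or it is rs itself.
Addable : ∀ {m} → Adj m → Fin m → Fin m → Fin m → Fin m → Set
Addable K r s k l = K k l ≡ false ⊎ samePair k l r s ≡ true

module _ {m} (K : Adj m) (r s k l : Fin m) where
  replace-added : ∀ i j → samePair i j k l ≡ true → replace K r s k l i j ≡ true
  replace-added i j e rewrite e = refl

  replace-deleted : ∀ i j → samePair i j k l ≡ false → samePair i j r s ≡ true → replace K r s k l i j ≡ false
  replace-deleted i j e f rewrite e | f = refl

  replace-other : ∀ i j → samePair i j k l ≡ false → samePair i j r s ≡ false → replace K r s k l i j ≡ K i j
  replace-other i j e f rewrite e | f = refl

  replace-new-pair : replace K r s k l ≐ replace K r s l k
  replace-new-pair i j rewrite samePair-swapʳ i j k l = refl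

  replace-old-pair : replace K r s k l ≐ replace K s r k l
  replace-old-pair i j rewrite samePair-swapʳ i j r s = refl

  replace-symmetric : Symmetric K → Symmetric (replace K r s k l)
  replace-symmetric S i j rewrite samePair-swapˡ i j k l | samePair-swapˡ i j r s | S i j = refl

  addable-absent : Symmetric K → Addable K r s k l → ∀ {i j} → samePair i j k l ≡ true → samePair i j r s ≡ false →
    K i j ≡ false
  addable-absent S add {i} {j} e f with samePair-true {i = i} {j} e | add
  ... | inj₁ (refl , refl) | inj₁ absent = absent
  ... | inj₂ (refl , refl) | inj₁ absent = trans (S i j) absent
  ... | inj₁ (refl , refl) | inj₂ same = case trans (sym f) same of λ ()
  ... | inj₂ (refl , refl) | inj₂ same = case trans (sym f) (trans (samePair-swapˡ i j r s) same) of λ ()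

replace-cong : ∀ {m} {K K' : Adj m} r s k l → K ≐ K' → replace K r s k l ≐ replace K' r s k l
replace-cong r s k l e i j = cong (λ b → if samePair i j k l then true else if samePair i j r s then false else b) (e i j)

replace-same : ∀ {m} (K : Adj m) → Symmetric K → ∀ {r s} → K r s ≡ true → replace K r s r s ≐ K
replace-same K S {r} {s} Krs i j with samePair i j r s in e
... | false = refl
... | true with samePair-true {i = i} {j} e
...   | inj₁ (refl , refl) = sym Krs
...   | inj₂ (refl , refl) = sym (trans (S i j) Krs)

replace-twice : ∀ {m} (K : Adj m) → Symmetric K → ∀ {r s k l} c d → Addable K r s k l →
  replace (replace K r s k l) k l c d ≐ replace K r s c d
replace-twice K S {r} {s} {k} {l} c d add x y with samePair x y c d
... | true = refl
... | false with samePair x y k l in e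
...   | false = refl
...   | true with samePair x y r s in f
...     | true = refl
...     | false = sym (addable-absent K r s k l S add e f)

replace-^ : ∀ {m} (K : Adj m) r s k l (π : Permutation′ m) →
  (replace K r s k l ^ π) ≐ replace (K ^ π) (π ⟨$⟩ˡ r) (π ⟨$⟩ˡ s) (π ⟨$⟩ˡ k) (π ⟨$⟩ˡ l)
replace-^ K r s k l π i j =
  cong₂ (λ b c → if b then true else if c then false else K (π ⟨$⟩ʳ i) (π ⟨$⟩ʳ j)) (pair-relabel k l) (pair-relabel r s)
  where
  pair-relabel : ∀ a b → samePair (π ⟨$⟩ʳ i) (π ⟨$⟩ʳ j) a b ≡ samePair i j (π ⟨$⟩ˡ a) (π ⟨$⟩ˡ b)
  pair-relabel a b = trans (cong₂ (samePair (π ⟨$⟩ʳ i) (π ⟨$⟩ʳ j)) (sym (inverseʳ π)) (sym (inverseʳ π)))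
                           (samePair-inj (π ⟨$⟩ʳ_) (perm-injective π) i j _ _)

edge-distinct : ∀ {m} {K : Adj m} → IsSimple K → ∀ {r s} → K r s ≡ true → r ≢ s
edge-distinct S {r} Krs refl = case trans (sym Krs) (IsSimple.irrefl S r) of λ ()

-- A relabelling σ realising the replacement rs → kl witnesses its feasibility (via σ⁻¹) and lies in 𝓔_K.
generator : ∀ {m} {K : Adj m} {σ r s k l} → K r s ≡ true → k ≢ l → Addable K r s k l →
  (K ^ σ) ≐ replace K r s k l → InE K σ
generator {K = K} {σ} {r} {s} {k} {l} Krs k≢l add E =
  r , s , k , l , ((Krs , k≢l , add) , (flip σ , ≐-trans (^-cong (flip σ) (≐-sym E)) (^-inverseʳ K σ))) , E

-- If σ realises rs → kl then σ⁻¹ realises σk σl → σr σs; hence 𝓔_K is closed under inverses.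
generator-inverse : ∀ {m} {K : Adj m} → IsSimple K → ∀ {σ} → InE K σ → InE K (flip σ)
generator-inverse {K = K} S {σ} (r , s , k , l , ((Krs , k≢l , add) , _) , E) =
  generator {σ = flip σ} Kkl′ (edge-distinct S Krs ∘ perm-injective σ) add′ E′
  where
  K₀ = K ^ flip σ
  Sym₀ : Symmetric K₀
  Sym₀ i j = IsSimple.sym S _ _
  K≐ : K ≐ replace K₀ (σ ⟨$⟩ʳ r) (σ ⟨$⟩ʳ s) (σ ⟨$⟩ʳ k) (σ ⟨$⟩ʳ l)
  K≐ = ≐-trans (≐-sym (^-inverseʳ K σ)) (≐-trans (^-cong (flip σ) E) (replace-^ K r s k l (flip σ)))
  add₀ : Addable K₀ (σ ⟨$⟩ʳ r) (σ ⟨$⟩ʳ s) (σ ⟨$⟩ʳ k) (σ ⟨$⟩ʳ l)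
  add₀ = Sum.map (trans (cong₂ K (inverseˡ σ) (inverseˡ σ))) (trans (samePair-inj (σ ⟨$⟩ʳ_) (perm-injective σ) k l r s)) add
  E′ : (K ^ flip σ) ≐ replace K (σ ⟨$⟩ʳ k) (σ ⟨$⟩ʳ l) (σ ⟨$⟩ʳ r) (σ ⟨$⟩ʳ s)
  E′ = ≐-sym (≐-trans (replace-cong _ _ _ _ K≐)
             (≐-trans (replace-twice K₀ Sym₀ _ _ add₀)
                      (replace-same K₀ Sym₀ (trans (cong₂ K (inverseˡ σ) (inverseˡ σ)) Krs))))
  Kkl′ : K (σ ⟨$⟩ʳ k) (σ ⟨$⟩ʳ l) ≡ true
  Kkl′ = trans (E k l) (replace-added K r s k l k l (samePair-refl k l))
  add′ : Addable K (σ ⟨$⟩ʳ k) (σ ⟨$⟩ʳ l) (σ ⟨$⟩ʳ r) (σ ⟨$⟩ʳ s)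
  add′ with samePair r s k l in e
  ... | true = inj₂ (trans (samePair-inj (σ ⟨$⟩ʳ_) (perm-injective σ) r s k l) e)
  ... | false = inj₁ (trans (E r s) (replace-deleted K r s k l r s e (samePair-refl r s)))

orbit-invariant : ∀ {m} {K : Adj m} → IsSimple K → (P : Fin m → Set) →
  (∀ σ → InE K σ → ∀ a → P a → P (σ ⟨$⟩ʳ a)) →
  ∀ {π} → InSG K π → ∀ a → (P a → P (π ⟨$⟩ʳ a)) × (P (π ⟨$⟩ʳ a) → P a)
orbit-invariant S P pres (gen {σ} g) a =
  pres σ g a , λ p → subst P (inverseˡ σ) (pres (flip σ) (generator-inverse S {σ} g) (σ ⟨$⟩ʳ a) p)
orbit-invariant S P pres one a = (λ p → p) , (λ p → p)
orbit-invariant S P pres (comp {σ} g₁ g₂) a =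
  proj₁ (orbit-invariant S P pres g₂ (σ ⟨$⟩ʳ a)) ∘ proj₁ (orbit-invariant S P pres g₁ a) ,
  proj₂ (orbit-invariant S P pres g₁ a) ∘ proj₂ (orbit-invariant S P pres g₂ (σ ⟨$⟩ʳ a))
orbit-invariant S P pres (inv {σ} g) a =
  (λ p → proj₂ (orbit-invariant S P pres g (σ ⟨$⟩ˡ a)) (subst P (sym (inverseʳ σ)) p)) ,
  (λ p → subst P (inverseʳ σ) (proj₁ (orbit-invariant S P pres g (σ ⟨$⟩ˡ a)) p))
orbit-invariant S P pres (ext g e) a =
  subst P (e a) ∘ proj₁ (orbit-invariant S P pres g a) ,
  proj₂ (orbit-invariant S P pres g a) ∘ subst P (sym (e a))

module _ {m} {K K' : Adj m} (SK : Symmetric K) (SK' : Symmetric K') (a b : Fin m)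
  (row-a : ∀ y → K b (transpose a b ⟨$⟩ʳ y) ≡ K' a y)
  (row-b : ∀ y → K a (transpose a b ⟨$⟩ʳ y) ≡ K' b y)
  (rest : ∀ x y → x ≢ a → x ≢ b → y ≢ a → y ≢ b → K x y ≡ K' x y) where

  private
    τ = transpose a b

  swap-rows : (K ^ τ) ≐ K'
  swap-rows x y = by-x (x ≟ a) (x ≟ b)
    where
    by-x : Dec (x ≡ a) → Dec (x ≡ b) → K (τ ⟨$⟩ʳ x) (τ ⟨$⟩ʳ y) ≡ K' x y
    by-x (yes refl) _ = trans (cong (λ v → K v (τ ⟨$⟩ʳ y)) (transpose-left a b)) (row-a y)
    by-x (no _) (yes refl) = trans (cong (λ v → K v (τ ⟨$⟩ʳ y)) (transpose-right a b)) (row-b y)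
    by-x (no x≢a) (no x≢b) = trans (cong (λ v → K v (τ ⟨$⟩ʳ y)) τx) (by-y (y ≟ a) (y ≟ b))
      where
      τx : τ ⟨$⟩ʳ x ≡ x
      τx = transpose-other a b x≢a x≢b
      by-y : Dec (y ≡ a) → Dec (y ≡ b) → K x (τ ⟨$⟩ʳ y) ≡ K' x y
      by-y (yes refl) _ = trans (cong (K x) (transpose-left a b))
        (trans (SK x b) (trans (cong (K b) (sym τx)) (trans (row-a x) (SK' a x))))
      by-y (no _) (yes refl) = trans (cong (K x) (transpose-right a b))
        (trans (SK x a) (trans (cong (K a) (sym τx)) (trans (row-b x) (SK' b x))))
      by-y (no y≢a) (no y≢b) = trans (cong (K x) (transpose-other a b y≢a y≢b)) (rest x y x≢a x≢b y≢a y≢b)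

swap-isolated : ∀ {m} {K : Adj m} → Symmetric K → ∀ a b → Isolated K a → Isolated K b → (K ^ transpose a b) ≐ K
swap-isolated S a b Ia Ib =
  swap-rows S S a b (λ y → trans (Ib _) (sym (Ia y))) (λ y → trans (Ia _) (sym (Ib y))) (λ _ _ _ _ _ _ → refl)

-- If K has an edge rs, the transposition of two isolated vertices lies in S_K(rs → rs).
swap-isolated-generator : ∀ {m} {K : Adj m} → IsSimple K → ∀ {r s} → K r s ≡ true →
  ∀ {a b} → Isolated K a → Isolated K b → InE K (transpose a b)
swap-isolated-generator {K = K} S {r} {s} Krs {a} {b} Ia Ib =
  generator {σ = transpose a b} Krs (edge-distinct S Krs) (inj₂ (samePair-refl r s))
    (≐-trans (swap-isolated (IsSimple.sym S) a b Ia Ib) (≐-sym (replace-same K (IsSimple.sym S) Krs)))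

Pendant : ∀ {m} → Adj m → Fin m → Fin m → Set
Pendant K l k = ∀ w → K l w ≡ (w == k)

move-pendant : ∀ {m} {K : Adj m} → Symmetric K → ∀ {u l k} → Isolated K u → Pendant K l k →
  k ≢ u → k ≢ l → u ≢ l → (K ^ transpose u l) ≐ replace K k l k u
move-pendant {K = K} S {u} {l} {k} Iu Pl k≢u k≢l u≢l =
  swap-rows S (replace-symmetric K k l k u S) u l row-u row-l rest
  where
  τ = transpose u l
  R = replace K k l k u
  row-u : ∀ y → K l (τ ⟨$⟩ʳ y) ≡ R u y
  row-u y = trans (Pl (τ ⟨$⟩ʳ y)) (trans relabel (sym R-row-u))
    where
    -- τ fixes k, so testing τ y against k is testing y against k.
    relabel : ((τ ⟨$⟩ʳ y) == k) ≡ (y == k)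
    relabel = trans (cong ((τ ⟨$⟩ʳ y) ==_) (sym (transpose-other u l k≢u k≢l)))
                    (==-inj (τ ⟨$⟩ʳ_) (perm-injective τ) y k)
    R-row-u : R u y ≡ (y == k)
    R-row-u rewrite samePair-swapʳ u y k u | samePair-hit y (k≢u ∘ sym)
                  | samePair-miss y (k≢u ∘ sym) u≢l with y == k
    ... | true = refl
    ... | false = Iu y
  row-l : ∀ y → K u (τ ⟨$⟩ʳ y) ≡ R l y
  row-l y rewrite Iu (τ ⟨$⟩ʳ y) | samePair-miss y (k≢l ∘ sym) (u≢l ∘ sym)
                | samePair-swapʳ l y k l | samePair-hit y (k≢l ∘ sym) with y == k in y=k
  ... | true = refl
  ... | false = sym (trans (Pl y) y=k)
  rest : ∀ x y → x ≢ u → x ≢ l → y ≢ u → y ≢ l → K x y ≡ R x y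
  rest x y x≢u x≢l y≢u y≢l =
    sym (replace-other K k l k u x y (samePair-avoid k x≢u y≢u) (samePair-avoid k x≢l y≢l))

-- If v_a has degree one (unique neighbour v_w) and v_z is isolated, the transposition (a z)
-- lies in S_K(aw → wz).
pendant-generator : ∀ {m} {K : Adj m} → IsSimple K → ∀ {a w z} → K a w ≡ true → (∀ j → K a j ≡ true → j ≡ w) →
  Isolated K z → a ≢ z → InE K (transpose a z)
pendant-generator {K = K} S {a} {w} {z} Kaw unique Iz a≢z =
  generator {σ = transpose a z} Kaw w≢z (inj₁ (isolated-col Sym Iz w))
    (≐-trans (^-ext K {transpose a z} {transpose z a} (transpose-comm a z))
    (≐-trans (move-pendant Sym Iz pendant w≢z (edge-distinct S Kaw ∘ sym) (a≢z ∘ sym))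
             (replace-old-pair K w a w z)))
  where
  Sym = IsSimple.sym S
  w≢z : w ≢ z
  w≢z refl = case trans (sym Kaw) (isolated-col Sym Iz a) of λ ()
  pendant : Pendant K a w
  pendant j with j ≟ w
  ... | yes refl = Kaw
  ... | no j≢w = not-true (j≢w ∘ unique j)

-- Counting isolated vertices: a feasible replacement that uses up an isolated vertex v_l
-- must isolate one of the endpoints of the deleted edge.

is-zero : ℕ → Bool
is-zero zero = true
is-zero (suc _) = false

isolatedᵇ : ∀ {m} → Adj m → Fin m → Bool
isolatedᵇ K v = is-zero (count (K v))

isolatedᵇ⁻ : ∀ {m} (K : Adj m) v → isolatedᵇ K v ≡ true → Isolated K v
isolatedᵇ⁻ K v e with count (K v) in c
... | zero = count-zero⁻ (K v) c

isolatedᵇ⁺ : ∀ {m} (K : Adj m) v → Isolated K v → isolatedᵇ K v ≡ true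
isolatedᵇ⁺ K v I rewrite count-zero⁺ (K v) I = refl

count-isolated-^ : ∀ {m} {K K' : Adj m} (π : Permutation′ m) → (K ^ π) ≐ K' →
  count (isolatedᵇ K') ≡ count (isolatedᵇ K)
count-isolated-^ {K = K} {K'} π E =
  trans (count-cong (λ x → cong is-zero (degree-^ {K = K} {K'} π E x))) (count-perm (isolatedᵇ K) π)

deleted-endpoint-isolated : ∀ {m} {K : Adj m} (σ : Permutation′ m) {r s k l} →
  K r s ≡ true → (K ^ σ) ≐ replace K r s k l → Isolated K l →
  Isolated (replace K r s k l) r ⊎ Isolated (replace K r s k l) s
deleted-endpoint-isolated {K = K} σ {r} {s} {k} {l} Krs E Il
  with isolatedᵇ (replace K r s k l) r in iso-r | isolatedᵇ (replace K r s k l) s in iso-s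
... | true | _ = inj₁ (isolatedᵇ⁻ (replace K r s k l) r iso-r)
... | false | true = inj₂ (isolatedᵇ⁻ (replace K r s k l) s iso-s)
... | false | false = ⊥-elim (n≮n _ (subst (_< count (isolatedᵇ K)) (count-isolated-^ {K = K} σ E) fewer))
  where
  K' = replace K r s k l
  still-isolated : ∀ v → isolatedᵇ K' v ≡ true → isolatedᵇ K v ≡ true
  still-isolated v e = isolatedᵇ⁺ K v I
    where
    I′ = isolatedᵇ⁻ K' v e
    v≢r : v ≢ r
    v≢r refl = false≢true (trans (sym iso-r) e)
    v≢s : v ≢ s
    v≢s refl = false≢true (trans (sym iso-s) e)
    I : Isolated K v
    I j with samePair v j k l in vj=kl
    ... | true = ⊥-elim (false≢true (trans (sym (I′ j)) (replace-added K r s k l v j vj=kl)))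
    ... | false = trans (sym (replace-other K r s k l v j vj=kl (samePair-miss j v≢r v≢s))) (I′ j)
  fewer : count (isolatedᵇ K') < count (isolatedᵇ K)
  fewer = count-strict _ _ still-isolated l
    (not-true λ e → false≢true (trans (sym (isolatedᵇ⁻ K' l e k)) (replace-added K r s k l l k (samePair-flip l k))))
    (isolatedᵇ⁺ K l Il)

record Tracked {m} (K : Adj m) (a b r s k l : Fin m) : Set where
  constructor tracked
  field
    π : Permutation′ m
    valid : IsEdgeReplacement K r s k l
    realises : (K ^ π) ≐ replace K r s k l
    busy : 2 ≤ count (replace K r s k l a)
    moves : π ⟨$⟩ʳ a ≡ b

tracked-swap : ∀ {m} {K : Adj m} → Symmetric K → ∀ {a b r s k l} → Tracked K a b r s k l → Tracked K a b r s l k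
tracked-swap {K = K} S {a} {r = r} {s} {k} {l} (tracked π (Krs , k≢l , add) E busy πa) =
  tracked π (Krs , k≢l ∘ sym , Sum.map (trans (S l k)) (trans (samePair-swapˡ l k r s)) add)
    (≐-trans E (replace-new-pair K r s k l))
    (subst (2 ≤_) (count-cong (replace-new-pair K r s k l a)) busy) πa

-- If the added pair kl ends at a vertex v_l isolated in K, then for one endpoint v_u of the
-- deleted edge the replacement rs → ku is realised as well: compose with the swap (u l),
-- which moves the pendant edge kl to ku.
reroute : ∀ {m} {K : Adj m} → IsSimple K → ∀ {a b r s k l} → Tracked K a b r s k l → Isolated K l →
  ∃ λ u → (u ≡ r ⊎ u ≡ s) × Tracked K a b r s k u
reroute {K = K} S {a} {b} {r} {s} {k} {l} (tracked π (Krs , k≢l , add) E busy πa) Il =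
  [ (λ Ir → r , inj₁ refl , rerouted r (inj₁ refl) Ir) , (λ Is → s , inj₂ refl , rerouted s (inj₂ refl) Is) ]′
    (deleted-endpoint-isolated {K = K} π Krs E Il)
  where
  Sym = IsSimple.sym S
  K' = replace K r s k l
  l≢r : l ≢ r
  l≢r refl = false≢true (trans (sym (Il s)) Krs)
  l≢s : l ≢ s
  l≢s refl = false≢true (trans (sym (Il r)) (trans (Sym l r) Krs))
  pendant-l : Pendant K' l k
  pendant-l w rewrite samePair-swapʳ l w k l | samePair-hit w (k≢l ∘ sym) | samePair-miss w l≢r l≢s
    with w == k
  ... | true = refl
  ... | false = Il w
  rerouted : ∀ u → (u ≡ r ⊎ u ≡ s) → Isolated K' u → Tracked K a b r s k u
  rerouted u u∈rs Iu = tracked (τ ∘ₚ π) (Krs , k≢u , add′) E′ busy′ (trans (cong (π ⟨$⟩ʳ_) τa) πa)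
    where
    τ = transpose u l
    u≢l : u ≢ l
    u≢l u≡l = [ (λ u≡r → l≢r (trans (sym u≡l) u≡r)) , (λ u≡s → l≢s (trans (sym u≡l) u≡s)) ]′ u∈rs
    k≢u : k ≢ u
    k≢u refl = false≢true (trans (sym (Iu l)) (replace-added K r s k l k l (samePair-refl k l)))
    moved : (K' ^ τ) ≐ replace K r s k u
    moved = ≐-trans (move-pendant (replace-symmetric K r s k l Sym) Iu pendant-l k≢u k≢l u≢l)
                    (replace-twice K Sym k u add)
    E′ : (K ^ (τ ∘ₚ π)) ≐ replace K r s k u
    E′ = ≐-trans (^-cong τ E) moved
    add′ : Addable K r s k u
    add′ with samePair k u r s in ku=rs
    ... | true = inj₂ refl
    ... | false = inj₁ (trans (sym (replace-other K r s k l k u ku≢kl ku=rs)) (trans (replace-symmetric K r s k l Sym k u) (Iu k)))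
      where
      ku≢kl : samePair k u k l ≡ false
      ku≢kl = trans (samePair-hit u k≢l) (==-false u≢l)
    -- v_a is neither the isolated v_u nor the pendant v_l of K', so τ fixes it.
    τa : τ ⟨$⟩ʳ a ≡ a
    τa = transpose-other u l a≢u a≢l
      where
      a≢u : a ≢ u
      a≢u refl = case subst (2 ≤_) (count-zero⁺ (K' a) Iu) busy of λ ()
      a≢l : a ≢ l
      a≢l refl = case ≤-trans busy (count-≤1 (K' a) k (λ j e → ==-true (trans (sym (pendant-l j)) e))) of λ { (s≤s ()) }
    busy′ : 2 ≤ count (replace K r s k u a)
    busy′ = subst (2 ≤_) (trans (cong (count ∘ K') (sym τa)) (sym (degree-^ {K = K'} τ moved a))) busy

-- Each step composes with a swap of two isolated vertices.
fix-isolated : ∀ {m} {K K' : Adj m} → Symmetric K → (π : Permutation′ m) → (K ^ π) ≐ K' →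
  (zs : List (Fin m)) → (∀ z → z ∈ zs → Isolated K z) → (∀ z → z ∈ zs → Isolated K' z) →
  Σ (Permutation′ m) λ θ → (K ^ θ) ≐ K' × (∀ z → z ∈ zs → θ ⟨$⟩ʳ z ≡ z) ×
    (∀ x → ¬ Isolated K' x → θ ⟨$⟩ʳ x ≡ π ⟨$⟩ʳ x)
fix-isolated S π E [] I I′ = π , E , (λ _ ()) , (λ _ _ → refl)
fix-isolated {K = K} {K'} S π E (z ∷ zs) I I′ = θ ∘ₚ τ , E′ , fixes′ , agrees′
  where
  previous = fix-isolated S π E zs (λ z′ → I z′ ∘ there) (λ z′ → I′ z′ ∘ there)
  θ = proj₁ previous
  Eθ = proj₁ (proj₂ previous)
  fixes = proj₁ (proj₂ (proj₂ previous))
  agrees = proj₂ (proj₂ (proj₂ previous))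
  w = θ ⟨$⟩ʳ z
  τ = transpose w z
  Iw : Isolated K w
  Iw = isolated-^⁻ {K = K} {K'} θ Eθ z (I′ z (here refl))
  Iz : Isolated K z
  Iz = I z (here refl)
  E′ : (K ^ (θ ∘ₚ τ)) ≐ K'
  E′ = ≐-trans (^-cong θ (swap-isolated S w z Iw Iz)) Eθ
  fixes′ : ∀ z′ → z′ ∈ z ∷ zs → τ ⟨$⟩ʳ (θ ⟨$⟩ʳ z′) ≡ z′
  fixes′ z′ (here refl) = transpose-left w z
  fixes′ z′ (there z′∈zs) with z′ ≟ z
  ... | yes refl = transpose-left w z
  ... | no z′≢z = trans (cong (τ ⟨$⟩ʳ_) θz′) (transpose-other w z (z′≢z ∘ perm-injective θ ∘ trans θz′) z′≢z)
    where θz′ = fixes z′ z′∈zs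
  agrees′ : ∀ x → ¬ Isolated K' x → τ ⟨$⟩ʳ (θ ⟨$⟩ʳ x) ≡ π ⟨$⟩ʳ x
  agrees′ x busy = trans (transpose-other w z (not-isolated Iw) (not-isolated Iz)) (agrees x busy)
    where
    not-isolated : ∀ {v} → Isolated K v → θ ⟨$⟩ʳ x ≢ v
    not-isolated Iv e = busy (isolated-^⁺ {K = K} {K'} θ Eθ x (subst (Isolated K) (sym e) Iv))

module Extension (n t : ℕ) where

  old : Fin n → Fin (n + t)
  old b = b ↑ˡ t

  new : Fin t → Fin (n + t)
  new j = n ↑ʳ j

  old-injective : ∀ {b c} → old b ≡ old c → b ≡ c
  old-injective {b} {c} = ↑ˡ-injective t b c

  old≢new : ∀ b j → old b ≢ new j
  old≢new b j e = case trans (sym (splitAt-↑ˡ n b t)) (trans (cong (splitAt n) e) (splitAt-↑ʳ n t j)) of λ ()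

  data View : Fin (n + t) → Set where
    is-old : ∀ b → View (old b)
    is-new : ∀ j → View (new j)

  view : ∀ x → View x
  view x with splitAt n x in e
  ... | inj₁ b = subst View (splitAt⁻¹-↑ˡ e) (is-old b)
  ... | inj₂ j = subst View (splitAt⁻¹-↑ʳ e) (is-new j)

  split : ∀ x → (∃ λ b → x ≡ old b) ⊎ (∃ λ j → x ≡ new j)
  split x with view x
  ... | is-old b = inj₁ (b , refl)
  ... | is-new j = inj₂ (j , refl)

  module _ (G : Adj n) where
    private
      H = addIsolated G t

    H-old : ∀ b c → H (old b) (old c) ≡ G b c
    H-old b c rewrite splitAt-↑ˡ n b t | splitAt-↑ˡ n c t = refl

    new-isolated : ∀ j → Isolated H (new j)
    new-isolated j y rewrite splitAt-↑ʳ n t j = refl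

    H-new-col : ∀ x j → H x (new j) ≡ false
    H-new-col x j with view x
    ... | is-old b rewrite splitAt-↑ˡ n b t | splitAt-↑ʳ n t j = refl
    ... | is-new i = new-isolated i (new j)

    H-simple : IsSimple G → IsSimple H
    H-simple S = record { sym = H-sym ; irrefl = H-irrefl }
      where
      H-sym : ∀ x y → H x y ≡ H y x
      H-sym x y with view x | view y
      ... | is-old b | is-old c = trans (H-old b c) (trans (IsSimple.sym S b c) (sym (H-old c b)))
      ... | is-old b | is-new j = trans (H-new-col (old b) j) (sym (new-isolated j (old b)))
      ... | is-new i | is-old c = trans (new-isolated i (old c)) (sym (H-new-col (old c) i))
      ... | is-new i | is-new j = trans (new-isolated i _) (sym (new-isolated j _))
      H-irrefl : ∀ x → H x x ≡ false
      H-irrefl x with view x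
      ... | is-old b = trans (H-old b b) (IsSimple.irrefl S b)
      ... | is-new j = new-isolated j _

    edge-old : ∀ x y → H x y ≡ true → ∃ λ b → x ≡ old b
    edge-old x y e with view x
    ... | is-old b = b , refl
    ... | is-new j = case trans (sym e) (new-isolated j y) of λ ()

    isolated-old⁺ : ∀ b → Isolated G b → Isolated H (old b)
    isolated-old⁺ b I y with view y
    ... | is-old c = trans (H-old b c) (I c)
    ... | is-new j = H-new-col (old b) j

    isolated-old⁻ : ∀ b → Isolated H (old b) → Isolated G b
    isolated-old⁻ b I c = trans (sym (H-old b c)) (I (old c))

    degree-old : ∀ b → count (H (old b)) ≡ deg G b
    degree-old b = trans (count-split (H (old b)))
      (trans (cong₂ _+_ (count-cong (H-old b)) (count-zero⁺ _ (H-new-col (old b))))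
             (trans (+-identityʳ _) (sym (deg≡count G b))))
      where
      count-split : ∀ {n′} (f : Fin (n′ + t) → Bool) → count f ≡ count (λ c → f (c ↑ˡ t)) + count (λ j → f (n′ ↑ʳ j))
      count-split {zero} f = refl
      count-split {suc n′} f = trans (cong (b2n (f zero) +_) (count-split (f ∘ suc)))
                                      (sym (+-assoc (b2n (f zero)) _ _))

  H-cong : ∀ {G G' : Adj n} → G ≐ G' → addIsolated G t ≐ addIsolated G' t
  H-cong {G} {G'} e x y with view x | view y
  ... | is-old b | is-old c = trans (H-old G b c) (trans (e b c) (sym (H-old G' b c)))
  ... | is-old b | is-new j = trans (H-new-col G _ j) (sym (H-new-col G' _ j))
  ... | is-new i | _ = trans (new-isolated G i y) (sym (new-isolated G' i y))

  replace-old : (G : Adj n) → ∀ r s k l →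
    replace (addIsolated G t) (old r) (old s) (old k) (old l) ≐ addIsolated (replace G r s k l) t
  replace-old G r s k l x y with view x | view y
  ... | is-old b | is-old c
    rewrite samePair-inj old old-injective b c k l | samePair-inj old old-injective b c r s
          | H-old G b c | H-old (replace G r s k l) b c = refl
  ... | is-new j | _ rewrite new-isolated (replace G r s k l) j y
                           | samePair-miss y (old≢new k j ∘ sym) (old≢new l j ∘ sym)
                           | samePair-miss y (old≢new r j ∘ sym) (old≢new s j ∘ sym) = new-isolated G j y
  ... | is-old b | is-new j rewrite H-new-col (replace G r s k l) (old b) j
                                  | samePair-swapˡ (old b) (new j) (old k) (old l)
                                  | samePair-swapˡ (old b) (new j) (old r) (old s)
                                  | samePair-miss (old b) (old≢new k j ∘ sym) (old≢new l j ∘ sym)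
                                  | samePair-miss (old b) (old≢new r j ∘ sym) (old≢new s j ∘ sym) = H-new-col G (old b) j

  lift : Permutation′ n → Permutation′ (n + t)
  lift σ = permutation (extend σ) (extend (flip σ)) (extend-inverse (flip σ)) (extend-inverse σ)
    where
    extend : Permutation′ n → Fin (n + t) → Fin (n + t)
    extend σ x = join n t (Sum.map (σ ⟨$⟩ʳ_) (λ j → j) (splitAt n x))
    extend-inverse : ∀ σ x → extend (flip σ) (extend σ x) ≡ x
    extend-inverse σ x with view x
    ... | is-old b rewrite splitAt-↑ˡ n b t | splitAt-↑ˡ n (σ ⟨$⟩ʳ b) t = cong old (inverseˡ σ)
    ... | is-new j rewrite splitAt-↑ʳ n t j | splitAt-↑ʳ n t j = refl

  lift-old : ∀ σ b → lift σ ⟨$⟩ʳ old b ≡ old (σ ⟨$⟩ʳ b)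
  lift-old σ b rewrite splitAt-↑ˡ n b t = refl

  lift-new : ∀ σ j → lift σ ⟨$⟩ʳ new j ≡ new j
  lift-new σ j rewrite splitAt-↑ʳ n t j = refl

  agree-on-views : ∀ (π ρ : Permutation′ (n + t)) → (∀ b → π ⟨$⟩ʳ old b ≡ ρ ⟨$⟩ʳ old b) →
    (∀ j → π ⟨$⟩ʳ new j ≡ ρ ⟨$⟩ʳ new j) → ∀ x → π ⟨$⟩ʳ x ≡ ρ ⟨$⟩ʳ x
  agree-on-views π ρ on-old on-new x with view x
  ... | is-old b = on-old b
  ... | is-new j = on-new j

  lift-^ : (G : Adj n) (σ : Permutation′ n) → (addIsolated G t ^ lift σ) ≐ addIsolated (G ^ σ) t
  lift-^ G σ x y with view x | view y
  ... | is-old b | is-old c rewrite lift-old σ b | lift-old σ c = trans (H-old G _ _) (sym (H-old (G ^ σ) b c))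
  ... | is-old b | is-new j rewrite lift-new σ j = trans (H-new-col G _ j) (sym (H-new-col (G ^ σ) _ j))
  ... | is-new i | _ rewrite lift-new σ i = trans (new-isolated G i _) (sym (new-isolated (G ^ σ) i y))

  -- Lifting embeds S_G into S_{G ∪ tK₁}: generators lift to generators.
  lift-InSG : (G : Adj n) → ∀ {σ} → InSG G σ → InSG (addIsolated G t) (lift σ)
  lift-InSG G (gen {σ} (r , s , k , l , ((Grs , k≢l , add) , _) , E)) = gen (generator {σ = lift σ}
    (trans (H-old G r s) Grs) (k≢l ∘ old-injective)
    (Sum.map (trans (H-old G k l)) (trans (samePair-inj old old-injective k l r s)) add)
    (≐-trans (lift-^ G σ) (≐-trans (H-cong E) (≐-sym (replace-old G r s k l)))))
  lift-InSG G one = ext one (agree-on-views id (lift id) (λ b → sym (lift-old id b)) (λ j → sym (lift-new id j)))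
  lift-InSG G (comp {σ} {ρ} g₁ g₂) = ext (comp (lift-InSG G g₁) (lift-InSG G g₂))
    (agree-on-views (lift σ ∘ₚ lift ρ) (lift (σ ∘ₚ ρ))
      (λ b → trans (cong (lift ρ ⟨$⟩ʳ_) (lift-old σ b)) (trans (lift-old ρ _) (sym (lift-old (σ ∘ₚ ρ) b))))
      (λ j → trans (cong (lift ρ ⟨$⟩ʳ_) (lift-new σ j)) (trans (lift-new ρ j) (sym (lift-new (σ ∘ₚ ρ) j)))))
  lift-InSG G (inv {σ} g) = ext {σ = flip (lift σ)} (inv (lift-InSG G g)) (λ _ → refl)
  lift-InSG G (ext {σ} {τ} g e) = ext (lift-InSG G g)
    (agree-on-views (lift σ) (lift τ)
      (λ b → trans (lift-old σ b) (trans (cong old (e b)) (sym (lift-old τ b))))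
      (λ j → trans (lift-new σ j) (sym (lift-new τ j))))

  module Restrict (θ : Permutation′ (n + t)) (fixes : ∀ j → θ ⟨$⟩ʳ new j ≡ new j) where
    private
      fixes⁻¹ : ∀ j → θ ⟨$⟩ˡ new j ≡ new j
      fixes⁻¹ j = trans (cong (θ ⟨$⟩ˡ_) (sym (fixes j))) (inverseˡ θ)

      stays-old : (π : Permutation′ (n + t)) → (∀ j → π ⟨$⟩ʳ new j ≡ new j) → ∀ b → ∃ λ c → π ⟨$⟩ʳ old b ≡ old c
      stays-old π fix b with split (π ⟨$⟩ʳ old b)
      ... | inj₁ old-c = old-c
      ... | inj₂ (j , e) = ⊥-elim (old≢new b j (perm-injective π (trans e (sym (fix j)))))

    restrict : Permutation′ n
    restrict = permutation (proj₁ ∘ stays-old θ fixes) (proj₁ ∘ stays-old (flip θ) fixes⁻¹)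
      (λ b → old-injective (trans (sym (proj₂ (stays-old θ fixes _)))
               (trans (cong (θ ⟨$⟩ʳ_) (sym (proj₂ (stays-old (flip θ) fixes⁻¹ b)))) (inverseʳ θ))))
      (λ b → old-injective (trans (sym (proj₂ (stays-old (flip θ) fixes⁻¹ _)))
               (trans (cong (θ ⟨$⟩ˡ_) (sym (proj₂ (stays-old θ fixes b)))) (inverseˡ θ))))

    restrict-old : ∀ b → old (restrict ⟨$⟩ʳ b) ≡ θ ⟨$⟩ʳ old b
    restrict-old b = sym (proj₂ (stays-old θ fixes b))

OrbitMeetsLeaf : ∀ {n} → Adj n → Set
OrbitMeetsLeaf {n} G = (x : Fin n) → Σ (Fin n) (λ y → InOrbit G x y × deg G y ≡ 1)

leaf-neighbour : ∀ {m} (K : Adj m) y → deg K y ≡ 1 → ∃ λ w → K y w ≡ true × (∀ j → K y j ≡ true → j ≡ w)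
leaf-neighbour K y d with count-witness (K y) (trans (sym (deg≡count K y)) d)
... | w , Kyw = w , Kyw , unique
  where
  unique : ∀ j → K y j ≡ true → j ≡ w
  unique j Kyj with j ≟ w
  ... | yes j≡w = j≡w
  ... | no j≢w = case subst (2 ≤_) (trans (sym (deg≡count K y)) d) (count-two (K y) j≢w Kyj Kyw) of λ { (s≤s ()) }

-- With z the first new vertex, every transposition (a z)
-- lies in S: for new a it swaps two isolated vertices; for old a = v_b, (ii) gives σ ∈ S_G with
-- σ b = y of degree one, (y z) is a generator, and (b z) is its conjugate by the lift of σ.
module Sufficiency (n t : ℕ) (G : Adj n) (S : IsSimple G) (NE : NonEmpty G) (leaves : OrbitMeetsLeaf G) where
  open Extension n (suc t)

  private
    H = addIsolated G (suc t)
    HS = H-simple G S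
    z = new zero

  transposition-old : ∀ b → InSG H (transpose (old b) z)
  transposition-old b with leaves b
  ... | y , (σ , σ∈SG , σb) , deg-y with leaf-neighbour G y deg-y
  ...   | w , Gyw , unique =
    ext {σ = lift σ ∘ₚ transpose (old y) z ∘ₚ flip (lift σ)}
        (comp (lift-InSG G σ∈SG) (comp {σ = transpose (old y) z} {ρ = flip (lift σ)} (gen leaf-swap) (inv (lift-InSG G σ∈SG))))
        (λ x → trans (sym (transpose-conj (lift σ) (old y) z x)) (cong₂ (λ u v → transpose u v ⟨$⟩ʳ x) σ⁻¹y σ⁻¹z))
    where
    unique-H : ∀ j → H (old y) j ≡ true → j ≡ old w
    unique-H j e with split j
    ... | inj₁ (c , refl) = cong old (unique c (trans (sym (H-old G y c)) e))
    ... | inj₂ (i , refl) = case trans (sym e) (H-new-col G (old y) i) of λ ()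
    leaf-swap : InE H (transpose (old y) z)
    leaf-swap = pendant-generator HS (trans (H-old G y w) Gyw) unique-H (new-isolated G zero) (old≢new y zero)
    σ⁻¹y : lift σ ⟨$⟩ˡ old y ≡ old b
    σ⁻¹y = trans (lift-old (flip σ) y) (cong old (trans (cong (σ ⟨$⟩ˡ_) (sym σb)) (inverseˡ σ)))
    σ⁻¹z : lift σ ⟨$⟩ˡ z ≡ z
    σ⁻¹z = lift-new (flip σ) zero

  transposition : ∀ a → InSG H (transpose a z)
  transposition a with split a
  ... | inj₁ (b , refl) = transposition-old b
  ... | inj₂ (j , refl) =
    gen (swap-isolated-generator HS (trans (H-old G i j′) Gij) (new-isolated G j) (new-isolated G zero))
    where
    i = proj₁ NE
    j′ = proj₁ (proj₂ NE)
    Gij = proj₂ (proj₂ NE)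

  sufficient : LocalAmoeba H
  sufficient = every-permutation H z transposition

isolated-gains-one : ∀ {m} (K : Adj m) r s {k l a} → k ≢ l → Isolated K a → count (replace K r s k l a) ≤ 1
isolated-gains-one K r s {k} {l} {a} k≢l Ia = count-≤1 _ (if a == k then l else k) only
  where
  only : ∀ x → replace K r s k l a x ≡ true → x ≡ (if a == k then l else k)
  only x e with samePair a x k l in ax=kl
  ... | true with samePair-true {i = a} {x} ax=kl
  ...   | inj₁ (refl , refl) rewrite ==-refl a = refl
  ...   | inj₂ (refl , refl) rewrite ==-false (k≢l ∘ sym) = refl
  only x e | false with samePair a x r s
  ...   | true = case e of λ ()
  ...   | false = case trans (sym (Ia x)) e of λ ()

module Necessity (n t : ℕ) (G : Adj n) (S : IsSimple G) (NE : NonEmpty G) where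
  open Extension n (suc t)

  private
    H = addIsolated G (suc t)
    HS = H-simple G S
    z = new zero

  settle-end : ∀ {a c r₀ s₀ k l} → Tracked H a c (old r₀) (old s₀) k l →
    ∃ λ l₀ → Tracked H a c (old r₀) (old s₀) k (old l₀)
  settle-end {l = l} tr with split l
  ... | inj₁ (l₀ , refl) = l₀ , tr
  ... | inj₂ (j , refl) with reroute HS tr (new-isolated G j)
  ...   | u , inj₁ refl , tr′ = _ , tr′
  ...   | u , inj₂ refl , tr′ = _ , tr′

  settle : ∀ {a c r₀ s₀ k l} → Tracked H a c (old r₀) (old s₀) k l →
    ∃ λ k₀ → ∃ λ l₀ → Tracked H a c (old r₀) (old s₀) (old k₀) (old l₀)
  settle tr with settle-end tr
  ... | l₀ , tr₁ with settle-end (tracked-swap (IsSimple.sym HS) tr₁)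
  ...   | k₀ , tr₂ = l₀ , k₀ , tr₂

  -- A tracked replacement among old vertices descends to a generator of S_G: first adjust the
  -- relabelling to fix the new vertices, then restrict it to the old ones.
  descend : ∀ {b b' r₀ s₀ k₀ l₀} → Tracked H (old b) (old b') (old r₀) (old s₀) (old k₀) (old l₀) →
    Σ (Permutation′ n) λ ρ → InE G ρ × ρ ⟨$⟩ʳ b ≡ b'
  descend {b} {b'} {r₀} {s₀} {k₀} {l₀} (tracked π (Hrs , k≢l , add) E busy πb) = τ , τ∈E , τb
    where
    G' = replace G r₀ s₀ k₀ l₀
    K' = replace H (old r₀) (old s₀) (old k₀) (old l₀)
    news = tabulate new
    new-isolated-K' : ∀ x → x ∈ news → Isolated K' x
    new-isolated-K' x x∈ with ∈-tabulate⁻ {f = new} x∈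
    ... | j , refl = λ y → trans (replace-old G r₀ s₀ k₀ l₀ (new j) y) (new-isolated G' j y)
    new-isolated-H : ∀ x → x ∈ news → Isolated H x
    new-isolated-H x x∈ with ∈-tabulate⁻ {f = new} x∈
    ... | j , refl = new-isolated G j
    adjusted = fix-isolated (IsSimple.sym HS) π E news new-isolated-H new-isolated-K'
    θ = proj₁ adjusted
    Eθ = proj₁ (proj₂ adjusted)
    open Restrict θ (λ j → proj₁ (proj₂ (proj₂ adjusted)) (new j) (∈-tabulate⁺ {f = new} j))
    τ = restrict
    Eτ : (G ^ τ) ≐ G'
    Eτ x y = begin
      G (τ ⟨$⟩ʳ x) (τ ⟨$⟩ʳ y)                ≡⟨ sym (H-old G _ _) ⟩
      H (old (τ ⟨$⟩ʳ x)) (old (τ ⟨$⟩ʳ y))    ≡⟨ cong₂ H (restrict-old x) (restrict-old y) ⟩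
      H (θ ⟨$⟩ʳ old x) (θ ⟨$⟩ʳ old y)        ≡⟨ Eθ (old x) (old y) ⟩
      K' (old x) (old y)                       ≡⟨ replace-old G r₀ s₀ k₀ l₀ (old x) (old y) ⟩
      addIsolated G' (suc t) (old x) (old y)   ≡⟨ H-old G' x y ⟩
      G' x y                                   ∎
      where open ≡-Reasoning
    τ∈E : InE G τ
    τ∈E = generator {σ = τ} (trans (sym (H-old G r₀ s₀)) Hrs) (k≢l ∘ cong old)
      (Sum.map (trans (sym (H-old G k₀ l₀))) (trans (sym (samePair-inj old old-injective k₀ l₀ r₀ s₀))) add) Eτ
    old-b-busy : ¬ Isolated K' (old b)
    old-b-busy I = case subst (2 ≤_) (count-zero⁺ (K' (old b)) I) busy of λ ()
    τb : τ ⟨$⟩ʳ b ≡ b'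
    τb = old-injective (trans (restrict-old b) (trans (proj₂ (proj₂ (proj₂ adjusted)) (old b) old-b-busy) πb))

  generator-descends : ∀ {σ b b'} → InE H σ → σ ⟨$⟩ʳ old b ≡ old b' →
    (∀ {r s k l} → (H ^ σ) ≐ replace H r s k l → 2 ≤ count (replace H r s k l (old b))) →
    Σ (Permutation′ n) λ ρ → InE G ρ × ρ ⟨$⟩ʳ b ≡ b'
  generator-descends {σ} (r , s , k , l , (valid , _) , E) σb busy
    with edge-old G r s (proj₁ valid) | edge-old G s r (trans (IsSimple.sym HS s r) (proj₁ valid))
  ... | r₀ , refl | s₀ , refl with settle (tracked σ valid E (busy E) σb)
  ...   | k₀ , l₀ , tr = descend tr

  moved-degree : ∀ {σ a b' K'} → (H ^ σ) ≐ K' → σ ⟨$⟩ʳ a ≡ old b' → count (K' a) ≡ deg G b'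
  moved-degree {σ} {a} {b'} {K'} E e = trans (degree-^ {K = H} {K'} σ E a) (trans (cong (count ∘ H) e) (degree-old G b'))

  old-isolated : ∀ {x b} → x ≡ old b → deg G b ≡ 0 → Isolated H x
  old-isolated {b = b} refl d = isolated-old⁺ G b (count-zero⁻ (G b) (trans (sym (deg≡count G b)) d))

  Good : Fin (n + suc t) → Set
  Good a = Isolated H a ⊎ (∃ λ b → a ≡ old b × Σ (Fin n) λ y → InOrbit G b y × deg G y ≡ 1)

  good-step : ∀ σ → InE H σ → ∀ a → Good a → Good (σ ⟨$⟩ʳ a)
  good-step σ g@(r , s , k , l , ((_ , k≢l , _) , _) , E) a good with split (σ ⟨$⟩ʳ a)
  ... | inj₂ (j , e) = inj₁ (subst (Isolated H) (sym e) (new-isolated G j))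
  ... | inj₁ (b' , e) with deg G b' in d
  ...   | zero = inj₁ (old-isolated e d)
  ...   | suc zero = inj₂ (b' , e , b' , (id , one , refl) , d)
  ...   | suc (suc _) = from-good good
    where
    busy : ∀ {r s k l} → (H ^ σ) ≐ replace H r s k l → 2 ≤ count (replace H r s k l a)
    busy E′ = subst (2 ≤_) (sym (trans (moved-degree {σ} E′ e) d)) (s≤s (s≤s z≤n))
    from-good : Good a → Good (σ ⟨$⟩ʳ a)
    from-good (inj₁ Ia) = case ≤-trans (busy E) (isolated-gains-one H r s k≢l Ia) of λ { (s≤s ()) }
    from-good (inj₂ (b , refl , y , (τ , τ∈SG , τb) , dy)) with generator-descends {σ} g e busy
    ... | ρ , ρ∈E , ρb = inj₂ (b' , e , y , (flip ρ ∘ₚ τ , comp {σ = flip ρ} (inv (gen ρ∈E)) τ∈SG , ρ⁻¹τ) , dy)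
      where
      ρ⁻¹τ : τ ⟨$⟩ʳ (ρ ⟨$⟩ˡ b') ≡ y
      ρ⁻¹τ = trans (cong (τ ⟨$⟩ʳ_) (trans (cong (ρ ⟨$⟩ˡ_) (sym ρb)) (inverseˡ ρ))) τb

  isolated-step : (∀ y → deg G y ≢ 1) → ∀ σ → InE H σ → ∀ a → Isolated H a → Isolated H (σ ⟨$⟩ʳ a)
  isolated-step no-leaf σ (r , s , k , l , ((_ , k≢l , _) , _) , E) a Ia with split (σ ⟨$⟩ʳ a)
  ... | inj₂ (j , e) = subst (Isolated H) (sym e) (new-isolated G j)
  ... | inj₁ (b' , e) with deg G b' in d
  ...   | zero = old-isolated e d
  ...   | suc zero = ⊥-elim (no-leaf b' d)
  ...   | suc (suc _) =
    case subst (_≤ 1) (trans (moved-degree {σ} E e) d) (isolated-gains-one H r s k≢l Ia) of λ { (s≤s ()) }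

  module _ (local : LocalAmoeba H) where
    -- G has a leaf: otherwise the transposition swapping z with an endpoint of an edge of G
    -- would move the isolated vertex z to a non-isolated one.
    leaf-exists : ∃ λ y → deg G y ≡ 1
    leaf-exists with any? (λ y → deg G y ≟ℕ 1)
    ... | yes leaf = leaf
    ... | no no-leaf = ⊥-elim (false≢true (trans (sym (I (old j))) (trans (H-old G i j) Gij)))
      where
      i = proj₁ NE
      j = proj₁ (proj₂ NE)
      Gij = proj₂ (proj₂ NE)
      I : Isolated H (old i)
      I = subst (Isolated H) (transpose-left z (old i))
            (proj₁ (orbit-invariant HS (Isolated H) (isolated-step (λ y d → no-leaf (y , d)))
                      (local (transpose z (old i))) z) (new-isolated G zero))

    necessary : OrbitMeetsLeaf G
    necessary x with subst Good (transpose-left z (old x))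
                       (proj₁ (orbit-invariant HS Good good-step (local (transpose z (old x))) z)
                              (inj₁ (new-isolated G zero)))
    ... | inj₂ (b , e , orbit) = subst (λ v → Σ (Fin n) λ y → InOrbit G v y × deg G y ≡ 1) (sym (old-injective e)) orbit
    ... | inj₁ Ix with leaf-exists
    ...   | y , dy with leaf-neighbour G y dy
    ...     | w , Gyw , unique = y , (transpose y x , gen leaf-swap , transpose-right y x) , dy
      where
      Ix′ : Isolated G x
      Ix′ = isolated-old⁻ G x Ix
      leaf-swap : InE G (transpose y x)
      leaf-swap = pendant-generator S Gyw unique Ix′ (λ { refl → false≢true (trans (sym (Ix′ w)) Gyw) })

-- Theorem 3.8. (i) ⇒ (ii): some G ∪ (T+1)K₁ is a local amoeba. (ii) ⇒ (i): every G ∪ (t+1)K₁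
-- is one, so T = 1 works. (ii) ⇔ (iii) is the case of a single new vertex.
theorem3p8 : (n : ℕ) (G : Adj n) → IsSimple G → NonEmpty G →
    let cond-ii = (x : Fin n) → Σ (Fin n) (λ y → InOrbit G x y × deg G y ≡ 1) in
    ((GlobalAmoeba G → cond-ii) × (cond-ii → GlobalAmoeba G)) ×
    ((cond-ii → LocalAmoeba (addIsolated G 1)) × (LocalAmoeba (addIsolated G 1) → cond-ii))
theorem3p8 n G S NE =
  ( (λ { (T , amoeba) → Necessity.necessary n T G S NE (amoeba (suc T) (n≤1+n T)) })
  , (λ leaves → 1 , λ { zero () ; (suc t) _ → Sufficiency.sufficient n t G S NE leaves }) )
  , ( Sufficiency.sufficient n 0 G S NE
    , Necessity.necessary n 0 G S NE )
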